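{- Let $q$ be even and let $\Pi_q$ be a projective plane of order $q$ containing a hyperoval. If $r=q$, then $M_r(\Pi_q)=(q+1)(r-1)$.
   Context: A finite projective plane $\Pi_q$ of order $q\ge 2$ has $q^2+q+1$ points and $q^2+q+1$ lines; every line contains $q+1$ points, every point lies on $q+1$ lines, any two lines meet in exactly one point and any two points lie on exactly one line. A hyperoval is a set of $q+2$ points no three of which are collinear. $r$-neighbor line percolation: for a set $A$ of points let $A^0=A$ and for $s\ge1$ let $A^s=A^{s-1}\cup\{P: \exists \text{ line } l\ni P \text{ with } |l\cap A^{s-1}|\ge r\}$; $A$ percolates if $A^k$ equals the whole point set for some $k$. $M_r(\Pi_q)$ is the maximum size of a set of points that does not percolate. -}

module Defs where

open import Data.Nat using (ℕ; suc; _+_; _*_; _∸_; _≤_; _≤?_)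
open import Data.Nat.Properties using ()
open import Data.Bool using (Bool; true; false; _∧_; _∨_)
open import Data.Fin using (Fin)
open import Data.Fin.Properties using (any?)
open import Data.Fin.Subset using (Subset; _∈_; _∩_; ∣_∣; ⊤)
open import Data.Fin.Subset.Properties using (_∈?_)
open import Data.Vec using (lookup; tabulate)
open import Data.Product using (_×_; ∃)
open import Relation.Nullary using (¬_)
open import Relation.Nullary.Decidable using (⌊_⌋; _×-dec_)
open import Relation.Binary.PropositionalEquality using (_≡_)
open import Function.Base using (_∘_; id)

nPts : ℕ → ℕ
nPts q = q * q + q + 1

record ProjectivePlane (q : ℕ) : Set where
  field
    line : Fin (nPts q) → Subset (nPts q)
    linePts : ∀ l → ∣ line l ∣ ≡ q + 1
    ptLines : ∀ P → ∣ tabulate (λ l → lookup (line l) P) ∣ ≡ q + 1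
    meet : ∀ l m → ¬ l ≡ m → ∣ line l ∩ line m ∣ ≡ 1
    join : ∀ P Q → ¬ P ≡ Q →
           ∣ tabulate (λ l → lookup (line l) P ∧ lookup (line l) Q) ∣ ≡ 1

module _ {q : ℕ} (Π : ProjectivePlane q) where
  open ProjectivePlane Π

  IsHyperoval : Subset (nPts q) → Set
  IsHyperoval H = (∣ H ∣ ≡ q + 2) × (∀ l → ∣ line l ∩ H ∣ ≤ 2)

  HasHyperoval : Set
  HasHyperoval = ∃ IsHyperoval

  step : ℕ → Subset (nPts q) → Subset (nPts q)
  step r A = tabulate (λ P → lookup A P ∨
    ⌊ any? (λ l → (P ∈? line l) ×-dec (r ≤? ∣ line l ∩ A ∣)) ⌋)

  iter : ℕ → ℕ → Subset (nPts q) → Subset (nPts q)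
  iter r 0 A = A
  iter r (suc k) A = step r (iter r k A)

  Percolates : ℕ → Subset (nPts q) → Set
  Percolates r A = ∃ λ k → iter r k A ≡ ⊤

  -- M_r(Π) = m : m is the maximum size of a non-percolating set
  IsMaxNonPercolating : ℕ → ℕ → Set
  IsMaxNonPercolating r m =
    (∃ λ A → ¬ Percolates r A × ∣ A ∣ ≡ m) ×
    (∀ A → ¬ Percolates r A → ∣ A ∣ ≤ m)

-- Let H be a hyperoval. A point P of H is joined to the other q + 1 points of H by
-- the q + 1 lines through P, and no line meets H three times, so every line through P
-- is a secant with q - 1 points outside H. Hence the complement of H, of size
-- (q + 1)(q - 1), never gains a point under q-neighbour percolation. Conversely, if
-- the complement of A has at most q + 1 points, then for P outside A the q + 1 lines
-- through P cannot all meet the at most q other missing points, so some line through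
-- P carries q points of A; thus A fills the plane in a single step.
module Submission where

open import Defs
open import Data.Nat using (ℕ; _+_; _*_; _∸_; _≤_; _%_)
open import Relation.Binary.PropositionalEquality using (_≡_)

open import Data.Nat using (zero; suc; _<_; z≤n; s≤s; s≤s⁻¹; _≤?_; _<?_)
open import Data.Nat.Properties
  using ( +-*-semiring; +-mono-≤; +-monoˡ-≤; +-mono-<-≤; +-mono-≤-<; +-suc; +-comm; +-identityʳ; *-comm; *-zeroʳ
        ; ≤-trans; ≤-reflexive; >⇒≢; +-cancelʳ-≡; <⇒≱; ≰⇒>; ≮⇒≥; n≢0⇒n>0; <-irrefl; m+[n∸m]≡n; m+n∸n≡m
        ; ∸-monoʳ-≤; suc-injective; module ≤-Reasoning)
open import Data.Nat.Tactic.RingSolver using (solve-∀)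
open import Data.Bool using (Bool; true; false; _∧_; _∨_; not)
open import Data.Bool.Properties using (∧-assoc; ∧-identityʳ; ∧-zeroʳ; not-¬)
open import Data.Fin as Fin using (Fin; punchIn)
open import Data.Fin.Properties using (_≟_; any?; punchInᵢ≢i)
open import Data.Fin.Subset using (Subset; ∣_∣; _∩_; ∁; ⊤; _∈_; _∉_; Nonempty)
open import Data.Fin.Subset.Properties
  using (∣∁p∣≡n∸∣p∣; ∣p∣≤n; x∈p⇒x∉∁p; x∉p⇒x∈∁p; x∉∁p⇒x∈p; ∈⊤; _∈?_; nonempty?; Empty-unique; ∣⊥∣≡0)
open import Data.Vec using ([]; _∷_; lookup; tabulate)
open import Data.Vec.Properties
  using (lookup∘tabulate; tabulate∘lookup; tabulate-cong; lookup-zipWith; lookup-replicate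
        ; []=⇒lookup; lookup⇒[]=)
open import Data.Product using (_,_; _×_; ∃; proj₁; proj₂)
open import Function.Base using (_∘_)
open import Relation.Binary.PropositionalEquality
  using (refl; sym; trans; cong; cong₂; subst; subst₂; _≗_; _≢_; module ≡-Reasoning)
open import Relation.Nullary using (¬_; Dec; yes; no; does; contradiction)
open import Relation.Nullary.Decidable using (⌊_⌋; isYes≗does; dec-true; dec-false; _×-dec_)
open import Algebra.Properties.Semiring.Sum +-*-semiring
  using (sum; sum-syntax; sum-cong-≗; ∑-distrib-+; ∑-comm; *-distribˡ-sum; sum-remove; sum-replicate-zero)

private
  variable
    n : ℕ

toℕ : Bool → ℕ
toℕ false = 0
toℕ true  = 1

count : (Fin n → Bool) → ℕ
count f = sum (toℕ ∘ f)

infixl 7 _∩ᵇ_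
_∩ᵇ_ : (Fin n → Bool) → (Fin n → Bool) → Fin n → Bool
(f ∩ᵇ g) i = f i ∧ g i

_∖_ : (Fin n → Bool) → Fin n → Fin n → Bool
(f ∖ i) j = f j ∧ not (does (j ≟ i))

count-cong : {f g : Fin n → Bool} → f ≗ g → count f ≡ count g
count-cong f≗g = sum-cong-≗ (cong toℕ ∘ f≗g)

∣p∣≡count : (p : Subset n) → ∣ p ∣ ≡ count (lookup p)
∣p∣≡count []          = refl
∣p∣≡count (true ∷ p)  = cong suc (∣p∣≡count p)
∣p∣≡count (false ∷ p) = ∣p∣≡count p

∣tabulate∣≡count : (f : Fin n → Bool) → ∣ tabulate f ∣ ≡ count f
∣tabulate∣≡count f = trans (∣p∣≡count (tabulate f)) (count-cong (lookup∘tabulate f))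

∣p∩q∣≡count : (p q : Subset n) → ∣ p ∩ q ∣ ≡ count (lookup p ∩ᵇ lookup q)
∣p∩q∣≡count p q = trans (∣p∣≡count (p ∩ q)) (count-cong (λ i → lookup-zipWith _∧_ i p q))

∣p∩q∣+∣p∩∁q∣≡∣p∣ : (p q : Subset n) → ∣ p ∩ q ∣ + ∣ p ∩ ∁ q ∣ ≡ ∣ p ∣
∣p∩q∣+∣p∩∁q∣≡∣p∣ []          []          = refl
∣p∩q∣+∣p∩∁q∣≡∣p∣ (true ∷ p)  (true ∷ q)  = cong suc (∣p∩q∣+∣p∩∁q∣≡∣p∣ p q)
∣p∩q∣+∣p∩∁q∣≡∣p∣ (true ∷ p)  (false ∷ q) = trans (+-suc _ _) (cong suc (∣p∩q∣+∣p∩∁q∣≡∣p∣ p q))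
∣p∩q∣+∣p∩∁q∣≡∣p∣ (false ∷ p) (_ ∷ q)     = ∣p∩q∣+∣p∩∁q∣≡∣p∣ p q

∣p∣+∣∁p∣≡n : (p : Subset n) → ∣ p ∣ + ∣ ∁ p ∣ ≡ n
∣p∣+∣∁p∣≡n p = trans (cong (∣ p ∣ +_) (∣∁p∣≡n∸∣p∣ p)) (m+[n∸m]≡n (∣p∣≤n p))

∣p∣≡n∸∣∁p∣ : (p : Subset n) → ∣ p ∣ ≡ n ∸ ∣ ∁ p ∣
∣p∣≡n∸∣∁p∣ {n} p = trans (sym (m+n∸n≡m ∣ p ∣ ∣ ∁ p ∣)) (cong (_∸ ∣ ∁ p ∣) (∣p∣+∣∁p∣≡n p))

lookup≡false⇒∉ : {p : Subset n} {i : Fin n} → lookup p i ≡ false → i ∉ p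
lookup≡false⇒∉ i∉p i∈p = not-¬ ([]=⇒lookup i∈p) i∉p

∣p∣>0⇒Nonempty : (p : Subset n) → 0 < ∣ p ∣ → Nonempty p
∣p∣>0⇒Nonempty {n} p 0<∣p∣ with nonempty? p
... | yes nonempty = nonempty
... | no  empty    = contradiction (trans (cong ∣_∣ (Empty-unique empty)) (∣⊥∣≡0 n)) (>⇒≢ 0<∣p∣)

count-at : (f : Fin n → Bool) (i : Fin n) → count (λ j → f j ∧ does (j ≟ i)) ≡ toℕ (f i)
count-at {suc n} f i = begin
  sum t                       ≡⟨ sum-remove {i = i} t ⟩
  t i + sum (t ∘ punchIn i)   ≡⟨ cong₂ _+_ at-i elsewhere ⟩
  toℕ (f i) + 0               ≡⟨ +-identityʳ (toℕ (f i)) ⟩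
  toℕ (f i)                   ∎
  where
    open ≡-Reasoning
    t : Fin (suc n) → ℕ
    t j = toℕ (f j ∧ does (j ≟ i))
    at-i : t i ≡ toℕ (f i)
    at-i = cong toℕ (trans (cong (f i ∧_) (dec-true (i ≟ i) refl)) (∧-identityʳ (f i)))
    elsewhere : sum (t ∘ punchIn i) ≡ 0
    elsewhere = trans (sum-cong-≗ vanish) (sum-replicate-zero n)
      where
        vanish : ∀ j → t (punchIn i j) ≡ 0
        vanish j = cong toℕ (trans (cong (f (punchIn i j) ∧_) (dec-false (punchIn i j ≟ i) (punchInᵢ≢i i j)))
                                   (∧-zeroʳ (f (punchIn i j))))

∖-self : (f : Fin n → Bool) (i : Fin n) → (f ∖ i) i ≡ false
∖-self f i = trans (cong (λ b → f i ∧ not b) (dec-true (i ≟ i) refl)) (∧-zeroʳ (f i))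

count-split : (f g : Fin n → Bool) → count f ≡ count (f ∩ᵇ g) + count (f ∩ᵇ (not ∘ g))
count-split f g = trans (sum-cong-≗ (λ i → toℕ-split (f i) (g i)))
                          (∑-distrib-+ (toℕ ∘ (f ∩ᵇ g)) (toℕ ∘ (f ∩ᵇ (not ∘ g))))
  where
    toℕ-split : ∀ a b → toℕ a ≡ toℕ (a ∧ b) + toℕ (a ∧ not b)
    toℕ-split false b     = refl
    toℕ-split true  true  = refl
    toℕ-split true  false = refl

count-∖ : (f : Fin n → Bool) (i : Fin n) → f i ≡ true → count f ≡ suc (count (f ∖ i))
count-∖ f i fi = begin
  count f                                                  ≡⟨ count-split f (λ j → does (j ≟ i)) ⟩
  count (λ j → f j ∧ does (j ≟ i)) + count (f ∖ i)         ≡⟨ cong (_+ count (f ∖ i)) (count-at f i) ⟩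
  toℕ (f i) + count (f ∖ i)                                ≡⟨ cong (λ b → toℕ b + count (f ∖ i)) fi ⟩
  suc (count (f ∖ i))                                      ∎
  where open ≡-Reasoning

count-∩-∖ : (f g : Fin n → Bool) (i : Fin n) → f i ≡ true → g i ≡ true →
            count (f ∩ᵇ g) ≡ suc (count (f ∩ᵇ (g ∖ i)))
count-∩-∖ f g i fi gi = trans (count-∖ (f ∩ᵇ g) i (cong₂ _∧_ fi gi))
                              (cong suc (count-cong (λ j → ∧-assoc (f j) (g j) _)))

∑-mono-≤ : {f g : Fin n → ℕ} → (∀ i → f i ≤ g i) → sum f ≤ sum g
∑-mono-≤ {zero}  f≤g = z≤n
∑-mono-≤ {suc n} f≤g = +-mono-≤ (f≤g Fin.zero) (∑-mono-≤ (f≤g ∘ Fin.suc))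

∑-mono-< : {f g : Fin n → ℕ} → (∀ i → f i ≤ g i) → (j : Fin n) → f j < g j → sum f < sum g
∑-mono-< {suc n} f≤g Fin.zero    lt = +-mono-<-≤ lt (∑-mono-≤ (f≤g ∘ Fin.suc))
∑-mono-< {suc n} f≤g (Fin.suc j) lt = +-mono-≤-< (f≤g Fin.zero) (∑-mono-< (f≤g ∘ Fin.suc) j lt)

∑<∑⇒∃< : {f g : Fin n → ℕ} → sum f < sum g → ∃ λ i → f i < g i
∑<∑⇒∃< {zero}        ()
∑<∑⇒∃< {suc n} {f} {g} lt with f Fin.zero <? g Fin.zero
... | yes lt₀ = Fin.zero , lt₀
... | no  ge₀ with ∑<∑⇒∃< {f = f ∘ Fin.suc} {g ∘ Fin.suc} (≰⇒> (<⇒≱ lt ∘ +-mono-≤ (≮⇒≥ ge₀)))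
...   | i , ltᵢ = Fin.suc i , ltᵢ

weight-≤ : ∀ b {x} → (b ≡ true → x ≤ 1) → toℕ b * x ≤ toℕ b
weight-≤ false x≤1 = z≤n
weight-≤ true  x≤1 = subst (_≤ 1) (sym (+-identityʳ _)) (x≤1 refl)

weight-< : ∀ {b x} → b ≡ true → x ≡ 0 → toℕ b * x < toℕ b
weight-< refl refl = s≤s z≤n

weight-<⇒ : ∀ b x → toℕ b * x < toℕ b → b ≡ true × x ≡ 0
weight-<⇒ true zero    _ = refl , refl
weight-<⇒ true (suc x) (s≤s ())

module _ {q : ℕ} (Π : ProjectivePlane q) where
  open ProjectivePlane Π

  private
    N : ℕ
    N = nPts q

    incidence : Fin N → Fin N → Bool
    incidence l P = lookup (line l) P

  count-lines-through : (P : Fin N) → count (λ l → incidence l P) ≡ q + 1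
  count-lines-through P = trans (sym (∣tabulate∣≡count (λ l → incidence l P))) (ptLines P)

  count-lines-joining : (P Q : Fin N) → P ≢ Q → count (λ l → incidence l P ∧ incidence l Q) ≡ 1
  count-lines-joining P Q P≢Q =
    trans (sym (∣tabulate∣≡count (λ l → incidence l P ∧ incidence l Q))) (join P Q P≢Q)

  -- Double counting the flags (l, Q) with P, Q ∈ l and Q ∈ S: each Q ∈ S lies on exactly
  -- one line through P.
  ∑-lines-through≡count : (P : Fin N) (S : Fin N → Bool) → S P ≡ false →
    ∑[ l < N ] (toℕ (incidence l P) * count (lookup (line l) ∩ᵇ S)) ≡ count S
  ∑-lines-through≡count P S P∉S = begin
    ∑[ l < N ] (toℕ (incidence l P) * ∑[ Q < N ] toℕ (incidence l Q ∧ S Q))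
      ≡⟨ sum-cong-≗ (λ l → *-distribˡ-sum (toℕ (incidence l P)) (λ Q → toℕ (incidence l Q ∧ S Q))) ⟩
    ∑[ l < N ] ∑[ Q < N ] (toℕ (incidence l P) * toℕ (incidence l Q ∧ S Q))
      ≡⟨ ∑-comm (λ l Q → toℕ (incidence l P) * toℕ (incidence l Q ∧ S Q)) ⟩
    ∑[ Q < N ] ∑[ l < N ] (toℕ (incidence l P) * toℕ (incidence l Q ∧ S Q))
      ≡⟨ sum-cong-≗ (λ Q → trans (sum-cong-≗ (λ l → rearrange (incidence l P) (incidence l Q) (S Q)))
                                 (sym (*-distribˡ-sum (toℕ (S Q)) (λ l → toℕ (incidence l P ∧ incidence l Q))))) ⟩
    ∑[ Q < N ] (toℕ (S Q) * count (λ l → incidence l P ∧ incidence l Q))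
      ≡⟨ sum-cong-≗ joined ⟩
    count S ∎
    where
      open ≡-Reasoning
      rearrange : ∀ a b s → toℕ a * toℕ (b ∧ s) ≡ toℕ s * toℕ (a ∧ b)
      rearrange false b     s = sym (*-zeroʳ (toℕ s))
      rearrange true  false s = sym (*-zeroʳ (toℕ s))
      rearrange true  true  s = *-comm 1 (toℕ s)
      joined : ∀ Q → toℕ (S Q) * count (λ l → incidence l P ∧ incidence l Q) ≡ toℕ (S Q)
      joined Q with S Q in Q∈S
      ... | false = refl
      ... | true  = cong (1 *_) (count-lines-joining P Q (λ { refl → not-¬ Q∈S P∉S }))

  private
    reachable? : (r : ℕ) (A : Subset N) (P : Fin N) → Dec (∃ λ l → P ∈ line l × r ≤ ∣ line l ∩ A ∣)
    reachable? r A P = any? (λ l → (P ∈? line l) ×-dec (r ≤? ∣ line l ∩ A ∣))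

  step-fixed : {r : ℕ} {A : Subset N} →
               (∀ P l → P ∉ A → P ∈ line l → ∣ line l ∩ A ∣ < r) → step Π r A ≡ A
  step-fixed {r} {A} unreachable = trans (tabulate-cong unchanged) (tabulate∘lookup A)
    where
      unchanged : ∀ P → (lookup A P ∨ ⌊ reachable? r A P ⌋) ≡ lookup A P
      unchanged P with lookup A P in A[P]
      ... | true  = refl
      ... | false = trans (isYes≗does (reachable? r A P))
                          (dec-false (reachable? r A P) λ (l , P∈l , r≤) →
                            <⇒≱ (unreachable P l (lookup≡false⇒∉ A[P]) P∈l) r≤)

  step-full : {r : ℕ} {A : Subset N} →
              (∀ P → P ∉ A → ∃ λ l → P ∈ line l × r ≤ ∣ line l ∩ A ∣) → step Π r A ≡ ⊤
  step-full {r} {A} reachable = trans (tabulate-cong filled) (tabulate∘lookup ⊤)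
    where
      filled : ∀ P → (lookup A P ∨ ⌊ reachable? r A P ⌋) ≡ lookup ⊤ P
      filled P with lookup A P in A[P]
      ... | true  = sym (lookup-replicate P true)
      ... | false = trans (trans (isYes≗does (reachable? r A P))
                                 (dec-true (reachable? r A P) (reachable P (lookup≡false⇒∉ A[P]))))
                          (sym (lookup-replicate P true))

  iterate-fixed : {r : ℕ} {A : Subset N} → step Π r A ≡ A → ∀ k → iter Π r k A ≡ A
  iterate-fixed fixed zero    = refl
  iterate-fixed fixed (suc k) = trans (cong (step Π _) (iterate-fixed fixed k)) fixed

  fixed⇒¬percolates : {r : ℕ} {A : Subset N} {P : Fin N} →
                      step Π r A ≡ A → P ∉ A → ¬ Percolates Π r A
  fixed⇒¬percolates {P = P} fixed P∉A (k , full) =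
    P∉A (subst (P ∈_) (trans (sym full) (iterate-fixed fixed k)) ∈⊤)

  ∣line∩A∣+∣line∩∁A∣≡q+1 : (l : Fin N) (A : Subset N) → ∣ line l ∩ A ∣ + ∣ line l ∩ ∁ A ∣ ≡ q + 1
  ∣line∩A∣+∣line∩∁A∣≡q+1 l A = trans (∣p∩q∣+∣p∩∁q∣≡∣p∣ (line l) A) (linePts l)

  ∑-lines-through-∖ : (S : Subset N) (P : Fin N) →
    ∑[ l < N ] (toℕ (incidence l P) * count (lookup (line l) ∩ᵇ (lookup S ∖ P)))
      ≡ count (lookup S ∖ P)
  ∑-lines-through-∖ S P = ∑-lines-through≡count P (lookup S ∖ P) (∖-self (lookup S) P)

  ∣line∩S∣≡suc : {S : Subset N} {P : Fin N} (l : Fin N) → P ∈ S → P ∈ line l →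
    ∣ line l ∩ S ∣ ≡ suc (count (lookup (line l) ∩ᵇ (lookup S ∖ P)))
  ∣line∩S∣≡suc {S} {P} l P∈S P∈l =
    trans (∣p∩q∣≡count (line l) S)
          (count-∩-∖ (lookup (line l)) (lookup S) P ([]=⇒lookup P∈l) ([]=⇒lookup P∈S))

  module _ {H : Subset N} (hyperoval : IsHyperoval Π H) where

    hyperoval-secant : {P : Fin N} (l : Fin N) → P ∈ H → P ∈ line l → 2 ≤ ∣ line l ∩ H ∣
    hyperoval-secant {P} l P∈H P∈l rewrite ∣line∩S∣≡suc l P∈H P∈l =
      s≤s (n≢0⇒n>0 λ others≡0 →
        <-irrefl (trans total (sym (count-lines-through P)))
                 (∑-mono-< at-most-one l (weight-< ([]=⇒lookup P∈l) others≡0)))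
      where
        others : Fin N → ℕ
        others m = count (lookup (line m) ∩ᵇ (lookup H ∖ P))
        at-most-one : ∀ m → toℕ (incidence m P) * others m ≤ toℕ (incidence m P)
        at-most-one m = weight-≤ (incidence m P) λ P∈m →
          s≤s⁻¹ (subst (_≤ 2) (∣line∩S∣≡suc m P∈H (lookup⇒[]= P (line m) P∈m)) (proj₂ hyperoval m))
        total : ∑[ m < N ] (toℕ (incidence m P) * others m) ≡ q + 1
        total = trans (∑-lines-through-∖ H P)
                      (suc-injective (trans (sym (count-∖ (lookup H) P ([]=⇒lookup P∈H)))
                                     (trans (sym (∣p∣≡count H)) (trans (proj₁ hyperoval) (+-suc q 1)))))

    ∁-hyperoval-fixed : step Π q (∁ H) ≡ ∁ H
    ∁-hyperoval-fixed = step-fixed λ P l P∉∁H P∈l →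
      fewer (hyperoval-secant l (x∉∁p⇒x∈p P∉∁H) P∈l) (∣line∩A∣+∣line∩∁A∣≡q+1 l H)
      where
        fewer : ∀ {a b} → 2 ≤ a → a + b ≡ q + 1 → b < q
        fewer {a} {b} 2≤a a+b≡ = s≤s⁻¹ (subst (2 + b ≤_) (trans a+b≡ (+-comm q 1)) (+-monoˡ-≤ b 2≤a))

    ∁-hyperoval-¬percolates : ¬ Percolates Π q (∁ H)
    ∁-hyperoval-¬percolates
      with ∣p∣>0⇒Nonempty H (subst (0 <_) (trans (+-comm 2 q) (sym (proj₁ hyperoval))) (s≤s z≤n))
    ... | P , P∈H = fixed⇒¬percolates ∁-hyperoval-fixed (x∈p⇒x∉∁p P∈H)

  small-set-tangent : {S : Subset N} {P : Fin N} → P ∈ S → ∣ S ∣ ≤ q + 1 →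
                      ∃ λ l → P ∈ line l × ∣ line l ∩ S ∣ ≡ 1
  small-set-tangent {S} {P} P∈S small with ∑<∑⇒∃< fewer
    where
      others : Fin N → ℕ
      others m = count (lookup (line m) ∩ᵇ (lookup S ∖ P))
      fewer : ∑[ m < N ] (toℕ (incidence m P) * others m) < ∑[ m < N ] toℕ (incidence m P)
      fewer = subst₂ _<_ (sym (∑-lines-through-∖ S P)) (sym (count-lines-through P))
                (subst (_≤ q + 1) (trans (∣p∣≡count S) (count-∖ (lookup S) P ([]=⇒lookup P∈S))) small)
  ... | l , lt with weight-<⇒ (incidence l P) _ lt
  ... | P∈l , others≡0 = l , P∈l′ , trans (∣line∩S∣≡suc l P∈S P∈l′) (cong suc others≡0)
    where P∈l′ = lookup⇒[]= P (line l) P∈l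

  small-complement⇒percolates : {A : Subset N} → ∣ ∁ A ∣ ≤ q + 1 → Percolates Π q A
  small-complement⇒percolates {A} small = 1 , step-full reachable
    where
      reachable : ∀ P → P ∉ A → ∃ λ l → P ∈ line l × q ≤ ∣ line l ∩ A ∣
      reachable P P∉A with small-set-tangent (x∉p⇒x∈∁p P∉A) small
      ... | l , P∈l , tangent = l , P∈l , ≤-reflexive (sym (+-cancelʳ-≡ 1 _ q
            (trans (cong (∣ line l ∩ A ∣ +_) (sym tangent)) (∣line∩A∣+∣line∩∁A∣≡q+1 l A))))

nPts∸[q+2]≡[q+1]*[q∸1] : (q : ℕ) → 1 ≤ q → nPts q ∸ (q + 2) ≡ (q + 1) * (q ∸ 1)
nPts∸[q+2]≡[q+1]*[q∸1] (suc m) _ = trans (cong (_∸ (suc m + 2)) (split m)) (m+n∸n≡m _ (suc m + 2))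
  where
    split : ∀ m → suc m * suc m + suc m + 1 ≡ (suc m + 1) * m + (suc m + 2)
    split = solve-∀

proposition12 : (q : ℕ) → 2 ≤ q → q % 2 ≡ 0 → (Π : ProjectivePlane q) →
                HasHyperoval Π → (r : ℕ) → r ≡ q →
                IsMaxNonPercolating Π r ((q + 1) * (r ∸ 1))
proposition12 q 2≤q _ Π (H , hyperoval) .q refl =
  (∁ H , ∁-hyperoval-¬percolates Π hyperoval , ∣∁H∣≡) , bound
  where
    complement-size : nPts q ∸ (q + 2) ≡ (q + 1) * (q ∸ 1)
    complement-size = nPts∸[q+2]≡[q+1]*[q∸1] q (≤-trans (s≤s z≤n) 2≤q)

    ∣∁H∣≡ : ∣ ∁ H ∣ ≡ (q + 1) * (q ∸ 1)
    ∣∁H∣≡ = trans (∣∁p∣≡n∸∣p∣ H) (trans (cong (nPts q ∸_) (proj₁ hyperoval)) complement-size)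

    bound : ∀ A → ¬ Percolates Π q A → ∣ A ∣ ≤ (q + 1) * (q ∸ 1)
    bound A ¬percolates = begin
      ∣ A ∣                    ≡⟨ ∣p∣≡n∸∣∁p∣ A ⟩
      nPts q ∸ ∣ ∁ A ∣         ≤⟨ ∸-monoʳ-≤ (nPts q) large-complement ⟩
      nPts q ∸ (q + 2)         ≡⟨ complement-size ⟩
      (q + 1) * (q ∸ 1)        ∎
      where
        open ≤-Reasoning
        large-complement : q + 2 ≤ ∣ ∁ A ∣
        large-complement = subst (_≤ ∣ ∁ A ∣) (sym (+-suc q 1))
                                 (≰⇒> (¬percolates ∘ small-complement⇒percolates Π))
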